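{- For all $n\geq 0$, $G_n \mathbin{+_c} G_1 \equiv G_{n+1}$, where $G_0=a$ and $G_{n+1}=\{a,b\mid G_n\}$ for $n\geq 0$ (game forms over $P_3$), and $+_c$ denotes concatenation.
   Context: Outcome poset $P_3=\{\bot,a,b,c,\top\}$ with $\bot<a,b,c<\top$ and $a,b,c$ pairwise incomparable. Each outcome corresponds to an equivalence relation on the terminal set $\{1,2,3\}$: $\bot$ the identity, $a$ identifies exactly $2,3$, $b$ exactly $1,3$, $c$ exactly $1,2$, $\top$ identifies all three. Game forms over a poset $A$: for each $x\in A$, $[x]$ (written $x$) is atomic; for nonempty sets $L,R$ of game forms, $\{L\mid R\}$ is composite with left options $L$ and right options $R$; atomic games have no options; all games are short. $G^{(L)}$ denotes a left option of $G$ if $G$ is composite and $G$ itself if atomic; similarly $G^{(R)}$. Mutually recursively: $G\leq H$ iff every $G^{(L)}$ satisfies $G^{(L)}\lhd H$ and every $H^{(R)}$ satisfies $G\lhd H^{(R)}$; $G\lhd H$ iff some $G^R\leq H$, or some $H^L$ satisfies $G\leq H^L$, or $G=[x],H=[y]$ are atomic with $x\leq y$. $G\equiv H$ iff $G\leq H$ and $H\leq G$. Sum: for posets $A,B,C$ and a monotone $f:A\times B\to C$, define $G+_fH=\{G^L+_fH,\ G+_fH^L\mid G^R+_fH,\ G+_fH^R\}$ (all options of this form) when at least one of $G,H$ is composite, and $[x]+_f[y]=[f(x,y)]$. Concatenation $+_c$ is the sum with $f:P_3\times P_3\to P_3$ defined as follows: for outcomes $x$ of a first position (terminals $1_G,2_G,3_G$)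 and $y$ of a second (terminals $1_H,2_H,3_H$), take the equivalence relation on $\{1_G,2_G,3_G,1_H,2_H,3_H\}$ generated by $x$ on the $G$-terminals, $y$ on the $H$-terminals, $1_G\sim 1_H$ and $2_G\sim 3_H$; its restriction to the new terminals $1:=1_G$, $2:=2_H$, $3:=3_G$ is the outcome $f(x,y)$. (In particular $a+_ca=a$, $a+_cb=b+_ca=b+_cb=b$.) -}

module Defs where

open import Data.Bool using (Bool; true; false; _∧_; _∨_; if_then_else_)
open import Data.Fin using (Fin; zero; suc)
open import Data.Fin.Properties using (_≟_)
open import Data.Nat using (ℕ; zero; suc)
open import Data.Product using (_×_; _,_)
open import Relation.Nullary.Decidable using (⌊_⌋)

data P₃ : Set where
  bot a b c top : P₃

data _≤P_ : P₃ → P₃ → Set where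
  bot≤ : ∀ {x} → bot ≤P x
  ≤top : ∀ {x} → x ≤P top
  a≤a  : a ≤P a
  b≤b  : b ≤P b
  c≤c  : c ≤P c

-- Game forms over a poset (carrier A, order _≤A_).
-- A nonempty finite set of options is a nonempty list (NE).

mutual
  data Game (A : Set) : Set where
    atom : A → Game A
    ⟨_∣_⟩ : NE A → NE A → Game A

  data NE (A : Set) : Set where
    [_]  : Game A → NE A
    _∷_  : Game A → NE A → NE A

infixr 5 _∷_

data _∈NE_ {A : Set} : Game A → NE A → Set where
  here[] : ∀ {g} → g ∈NE [ g ]
  here   : ∀ {g gs} → g ∈NE (g ∷ gs)
  there  : ∀ {g h gs} → g ∈NE gs → g ∈NE (h ∷ gs)

data IsLOpt⁺ {A : Set} : Game A → Game A → Set where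
  atomL : ∀ {x} → IsLOpt⁺ (atom x) (atom x)
  compL : ∀ {g L R} → g ∈NE L → IsLOpt⁺ g ⟨ L ∣ R ⟩

data IsROpt⁺ {A : Set} : Game A → Game A → Set where
  atomR : ∀ {x} → IsROpt⁺ (atom x) (atom x)
  compR : ∀ {g L R} → g ∈NE R → IsROpt⁺ g ⟨ L ∣ R ⟩

data IsLOpt {A : Set} : Game A → Game A → Set where
  compL : ∀ {g L R} → g ∈NE L → IsLOpt g ⟨ L ∣ R ⟩

data IsROpt {A : Set} : Game A → Game A → Set where
  compR : ∀ {g L R} → g ∈NE R → IsROpt g ⟨ L ∣ R ⟩

-- The mutually recursive relations ≤ and ⊲ (inductively defined,
-- which is well-founded since all games are short).
module Order {A : Set} (_≤A_ : A → A → Set) where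
  mutual
    data _≤G_ : Game A → Game A → Set where
      le : ∀ {G H}
         → (∀ {GL} → IsLOpt⁺ GL G → GL ⊲ H)
         → (∀ {HR} → IsROpt⁺ HR H → G ⊲ HR)
         → G ≤G H

    data _⊲_ : Game A → Game A → Set where
      viaGR : ∀ {G H GR} → IsROpt GR G → GR ≤G H → G ⊲ H
      viaHL : ∀ {G H HL} → IsLOpt HL H → G ≤G HL → G ⊲ H
      atoms : ∀ {x y} → x ≤A y → atom x ⊲ atom y

  _≡G_ : Game A → Game A → Set
  G ≡G H = (G ≤G H) × (H ≤G G)

appNE : {C : Set} → NE C → NE C → NE C
appNE [ g ] ys = g ∷ ys
appNE (g ∷ xs) ys = g ∷ appNE xs ys

module Sum {A B C : Set} (f : A → B → C) where
  mutual
    _+f_ : Game A → Game B → Game C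
    atom x +f atom y = atom (f x y)
    atom x +f ⟨ L ∣ R ⟩ = ⟨ rmapNE (atom x) L ∣ rmapNE (atom x) R ⟩
    ⟨ L ∣ R ⟩ +f atom y = ⟨ lmapNE L (atom y) ∣ lmapNE R (atom y) ⟩
    ⟨ L ∣ R ⟩ +f ⟨ L' ∣ R' ⟩ =
      ⟨ appNE (lmapNE L ⟨ L' ∣ R' ⟩) (rmapNE ⟨ L ∣ R ⟩ L')
      ∣ appNE (lmapNE R ⟨ L' ∣ R' ⟩) (rmapNE ⟨ L ∣ R ⟩ R') ⟩

    lmapNE : NE A → Game B → NE C
    lmapNE [ g ] H = [ g +f H ]
    lmapNE (g ∷ gs) H = (g +f H) ∷ lmapNE gs H

    rmapNE : Game A → NE B → NE C
    rmapNE G [ h ] = [ G +f h ]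
    rmapNE G (h ∷ hs) = (G +f h) ∷ rmapNE G hs


-- Concatenation outcome function f : P₃ × P₃ → P₃, computed as in the
-- paper: generate an equivalence relation on six terminals and restrict.

-- direct description: does outcome x identify distinct terminals i and j?
ident : P₃ → Fin 3 → Fin 3 → Bool
ident bot i j = ⌊ i ≟ j ⌋
ident top i j = true
ident a i j = ⌊ i ≟ j ⌋ ∨ (not0 i ∧ not0 j)
  where
  not0 : Fin 3 → Bool
  not0 zero = false
  not0 (suc _) = true
ident b i j = ⌊ i ≟ j ⌋ ∨ (not1 i ∧ not1 j)
  where
  not1 : Fin 3 → Bool
  not1 (suc zero) = false
  not1 _ = true
ident c i j = ⌊ i ≟ j ⌋ ∨ (not2 i ∧ not2 j)
  where
  not2 : Fin 3 → Bool
  not2 (suc (suc zero)) = false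
  not2 _ = true

-- Six terminals: 0,1,2 = 1_G,2_G,3_G and 3,4,5 = 1_H,2_H,3_H.
data Side : Set where
  inG inH : Side

split : Fin 6 → Side × Fin 3
split zero = inG , zero
split (suc zero) = inG , suc zero
split (suc (suc zero)) = inG , suc (suc zero)
split (suc (suc (suc zero))) = inH , zero
split (suc (suc (suc (suc zero)))) = inH , suc zero
split (suc (suc (suc (suc (suc zero))))) = inH , suc (suc zero)

gen : P₃ → P₃ → Fin 6 → Fin 6 → Bool
gen x y i j = base (split i) (split j)
  where
  base : Side × Fin 3 → Side × Fin 3 → Bool
  base (inG , p) (inG , q) = ident x p q
  base (inH , p) (inH , q) = ident y p q
  base (inG , p) (inH , q) = glue p q
    where
    glue : Fin 3 → Fin 3 → Bool
    glue zero zero = true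
    glue (suc zero) (suc (suc zero)) = true
    glue _ _ = false
  base (inH , q) (inG , p) = glue p q
    where
    glue : Fin 3 → Fin 3 → Bool
    glue zero zero = true
    glue (suc zero) (suc (suc zero)) = true
    glue _ _ = false

Rel6 : Set
Rel6 = Fin 6 → Fin 6 → Bool

anyFin : ∀ {n} → (Fin n → Bool) → Bool
anyFin {zero} p = false
anyFin {suc n} p = p zero ∨ anyFin (λ k → p (suc k))

-- relational composition R;R (R is reflexive, so this extends R)
square : Rel6 → Rel6
square R i j = anyFin (λ k → R i k ∧ R k j)

-- reflexive-transitive closure: 3 squarings cover paths of length ≤ 8 ≥ 5
closure : Rel6 → Rel6
closure R = square (square (square R))

-- the new terminals: 1 := 1_G, 2 := 2_H, 3 := 3_G
newT : Fin 3 → Fin 6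
newT zero = zero
newT (suc zero) = suc (suc (suc (suc zero)))
newT (suc (suc zero)) = suc (suc zero)

classify : Bool → Bool → Bool → P₃   -- arguments: 1~2, 1~3, 2~3
classify false false false = bot
classify false false true  = a
classify false true  false = b
classify true  false false = c
classify _     _     _     = top   -- remaining (transitive) case: all identified

fc : P₃ → P₃ → P₃
fc x y = classify (E zero (suc zero)) (E zero (suc (suc zero))) (E (suc zero) (suc (suc zero)))
  where
  E : Fin 3 → Fin 3 → Bool
  E p q = closure (gen x y) (newT p) (newT q)

open Order _≤P_ public
open Sum fc public renaming (_+f_ to _+c_)

Gseq : ℕ → Game P₃
Gseq zero = atom a
Gseq (suc n) = ⟨ atom a ∷ [ atom b ] ∣ [ Gseq n ] ⟩

-- Since a is a right identity of concatenation, the left options of Gseq (suc n) +c Gseq 1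
-- are Gseq 1, b +c Gseq 1, Gseq (suc n) and Gseq (suc n) +c b, and its right options are
-- Gseq n +c Gseq 1 and Gseq (suc n).  Adding b turns every leaf of Gseq into b, so the
-- b-options lie below b.  Comparing these options with those of Gseq (suc (suc n)) needs
-- only a ≤ Gseq n, monotonicity of Gseq, and, by induction, Gseq (suc n) ≤ Gseq n +c Gseq 1.
module Submission where

open import Defs
open import Data.Nat using (ℕ; zero; suc; _≤_; z≤n; s≤s)
open import Data.Nat.Properties using (m≤n+m)
open import Data.Product using (_,_)
open import Relation.Binary.PropositionalEquality using (_≡_; refl; cong; cong₂; subst; sym)

module OrderProperties {A : Set} (_≤A_ : A → A → Set) (≤A-refl : ∀ {x} → x ≤A x) where
  private module O = Order _≤A_

  mutual
    ≤G-refl : ∀ G → G O.≤G G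
    ≤G-refl (atom x) = O.le (λ { atomL → O.atoms ≤A-refl }) (λ { atomR → O.atoms ≤A-refl })
    ≤G-refl ⟨ L ∣ R ⟩ =
      O.le (λ { (compL g∈L) → O.viaHL (compL g∈L) (≤G-refl-∈ L g∈L) })
           (λ { (compR g∈R) → O.viaGR (compR g∈R) (≤G-refl-∈ R g∈R) })

    ≤G-refl-∈ : ∀ gs {g} → g ∈NE gs → g O.≤G g
    ≤G-refl-∈ [ g ] here[] = ≤G-refl g
    ≤G-refl-∈ (g ∷ gs) here = ≤G-refl g
    ≤G-refl-∈ (_ ∷ gs) (there g∈gs) = ≤G-refl-∈ gs g∈gs

module SumProperties {A : Set} (f : A → A → A) (e : A) (identityʳ : ∀ x → f x e ≡ x) where
  open Sum f using (_+f_) renaming (lmapNE to lmap)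

  mutual
    +f-identityʳ : ∀ G → G +f atom e ≡ G
    +f-identityʳ (atom x) = cong atom (identityʳ x)
    +f-identityʳ ⟨ L ∣ R ⟩ = cong₂ ⟨_∣_⟩ (lmap-identityʳ L) (lmap-identityʳ R)

    lmap-identityʳ : ∀ gs → lmap gs (atom e) ≡ gs
    lmap-identityʳ [ g ] = cong [_] (+f-identityʳ g)
    lmap-identityʳ (g ∷ gs) = cong₂ _∷_ (+f-identityʳ g) (lmap-identityʳ gs)

≤P-refl : ∀ {x} → x ≤P x
≤P-refl {bot} = bot≤
≤P-refl {a} = a≤a
≤P-refl {b} = b≤b
≤P-refl {c} = c≤c
≤P-refl {top} = ≤top

fc-identityʳ : ∀ x → fc x a ≡ x
fc-identityʳ bot = refl
fc-identityʳ a = refl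
fc-identityʳ b = refl
fc-identityʳ c = refl
fc-identityʳ top = refl

open OrderProperties _≤P_ ≤P-refl using (≤G-refl)
open SumProperties fc a fc-identityʳ using () renaming (+f-identityʳ to +c-identityʳ)

a⊲Gseq : ∀ n → atom a ⊲ Gseq n
a⊲Gseq zero = atoms a≤a
a⊲Gseq (suc n) = viaHL (compL here) (≤G-refl (atom a))

a≤Gseq : ∀ n → atom a ≤G Gseq n
a≤Gseq zero = ≤G-refl (atom a)
a≤Gseq (suc n) = le (λ { atomL → a⊲Gseq (suc n) }) (λ { (compR here[]) → a⊲Gseq n })

Gseq-mono : ∀ {i j} → i ≤ j → Gseq i ≤G Gseq j
Gseq-mono {j = j} z≤n = a≤Gseq j
Gseq-mono (s≤s i≤j) =
  le (λ { (compL here) → viaHL (compL here) (≤G-refl (atom a))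
        ; (compL (there here[])) → viaHL (compL (there here[])) (≤G-refl (atom b)) })
     (λ { (compR here[]) → viaGR (compR here[]) (Gseq-mono i≤j) })

Gseq+c-b≤b : ∀ n → (Gseq n +c atom b) ≤G atom b
Gseq+c-b≤b zero = ≤G-refl (atom b)
Gseq+c-b≤b (suc n) =
  le (λ { (compL here) → atoms b≤b ; (compL (there here[])) → atoms b≤b })
     (λ { atomR → viaGR (compR here[]) (Gseq+c-b≤b n) })

b≤b+cGseq1 : atom b ≤G (atom b +c Gseq 1)
b≤b+cGseq1 = le (λ { atomL → viaHL (compL here) (≤G-refl (atom b)) })
                (λ { (compR here[]) → atoms b≤b })

Gseq⊲Gseq-suc : ∀ n → Gseq n ⊲ Gseq (suc n)
Gseq⊲Gseq-suc zero = a⊲Gseq 1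
Gseq⊲Gseq-suc (suc n) = viaGR (compR here[]) (Gseq-mono (m≤n+m n 2))

sum≤Gseq : ∀ n → (Gseq n +c Gseq 1) ≤G Gseq (suc n)
sum≤Gseq zero = ≤G-refl (Gseq 1)
sum≤Gseq (suc n) =
  le (λ { (compL here) → viaGR (compR here[]) (a≤Gseq (suc (suc n)))
        -- b +c Gseq 1 and Gseq 1 +c b compute to the same game ⟨ b ∷ [ b ] ∣ [ b ] ⟩
        ; (compL (there here)) → viaHL (compL (there here[])) (Gseq+c-b≤b 1)
        ; (compL (there (there here))) →
            subst (_⊲ Gseq (suc (suc n))) (sym (+c-identityʳ _)) (Gseq⊲Gseq-suc (suc n))
        ; (compL (there (there (there here[])))) →
            viaHL (compL (there here[])) (Gseq+c-b≤b (suc n)) })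
     (λ { (compR here[]) →
            viaGR (compR (there here[]))
                  (subst (_≤G Gseq (suc n)) (sym (+c-identityʳ _)) (≤G-refl _)) })

Gseq≤sum : ∀ n → Gseq (suc n) ≤G (Gseq n +c Gseq 1)
Gseq≤sum zero = ≤G-refl (Gseq 1)
Gseq≤sum (suc n) =
  le (λ { (compL here) → viaHL (compL here) (a≤Gseq 1)
        ; (compL (there here[])) → viaHL (compL (there here)) b≤b+cGseq1 })
     (λ { (compR here) → viaGR (compR here[]) (Gseq≤sum n)
        ; (compR (there here[])) →
            viaGR (compR here[])
                  (subst (Gseq (suc n) ≤G_) (sym (+c-identityʳ _)) (≤G-refl _)) })

lemma4p1 : (n : ℕ) → (Gseq n +c Gseq 1) ≡G Gseq (suc n)
lemma4p1 n = sum≤Gseq n , Gseq≤sum n
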